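{- Let $\beta\subseteq\alpha$ be compositions and suppose the skew diagram $\alpha/\beta$ is a disjoint sum of nonempty skew shapes $A_1,\ldots,A_k$ such that $A_i$ and $A_j$ have no common row or column for $i\neq j$, and $A_i$ lies strictly above $A_{i+1}$ for $1\le i\le k-1$. Let $n_i=|A_i|$. If for each $i$ the poset $\mathrm{SET}(A_i)$ has a unique minimal element $M_i$, then $\mathrm{SET}(\alpha/\beta)$ has a unique minimal element, namely the tableau whose restriction to $A_i$ is obtained from $M_i$ by replacing each entry $a$ with $a+n_1+\cdots+n_{i-1}$, for each $i$.
   Context: A composition is a finite sequence of positive integers $\alpha=(\alpha_1,\ldots,\alpha_k)$; its diagram has $\alpha_i$ left-justified cells in row $i$, rows numbered from the bottom. For compositions $\beta\subseteq\alpha$ (i.e. $\ell(\beta)\le\ell(\alpha)$, $\beta_j\le\alpha_j$), the skew diagram $\alpha/\beta$ is the set of cells of the diagram of $\alpha$ not in that of $\beta$ (same bottom-left corner), $n=|\alpha/\beta|$. $\alpha/\beta$ is a disjoint sum of nonempty skew shapes $A_1,\ldots,A_k$ if these are pairwise disjoint subsets of cells with union $\alpha/\beta$, and for $i\ne j$ the smallest interval containing all rows (resp. columns) of $A_i$ is disjoint from the smallest interval containing all rows (resp. columns) of $A_j$. Each $A_i$ is itself regarded as a skew shape. For a skew shape $S$ with $m$ cells, a standard extended tableau of shape $S$ is a bijective filling of its cells with $1,\ldots,m$ strictly increasing left to right along rows and bottom to top along columns; $\mathrm{SET}(S)$ is the set of these. For $1\le i\le m-1$, $\pi_i(T)=T$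 if $i+1$ is in a strictly higher row than $i$, $\pi_i(T)=s_i(T)$ (swap $i$ and $i+1$) if $i+1$ is in a strictly lower row than $i$, and $\pi_i(T)=0$ if they are in the same row. Poset on $\mathrm{SET}(S)$: $S_1\le S_2$ iff $S_2$ is obtained from $S_1$ by a finite sequence of operators $\pi_i$ with all intermediate results nonzero. -}

module Defs where

open import Data.Nat using (ℕ; zero; suc; _<_; _≤_)
open import Data.Product using (_×_; _,_; proj₁; proj₂; ∃-syntax)
open import Data.Sum using (_⊎_)
open import Data.List using (List; []; _∷_; _++_; length; lookup; concat)
open import Data.List.Membership.Propositional using (_∈_; _∉_)
open import Data.List.Relation.Unary.All using (All)
open import Data.List.Relation.Unary.Any using (Any)
open import Data.List.Relation.Unary.Unique.Propositional using (Unique)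
open import Data.List.Relation.Unary.AllPairs using (AllPairs)
open import Data.List.Relation.Unary.Linked using (Linked)
open import Data.List.Relation.Binary.Pointwise using (Pointwise)
open import Relation.Binary.Construct.Closure.ReflexiveTransitive using (Star)
open import Data.Fin using (Fin; toℕ)
open import Relation.Binary.PropositionalEquality using (_≡_; _≢_)
open import Relation.Nullary using (¬_)

-- A composition: a finite list of positive integers (α₁, …, αₖ);
-- list index r (0-based) is row r+1, rows counted from the bottom.
IsComposition : List ℕ → Set
IsComposition α = All (λ a → 0 < a) α

data _⊆ᶜ_ : List ℕ → List ℕ → Set where
  []⊆ : ∀ {α} → [] ⊆ᶜ α
  ∷⊆  : ∀ {b a β α} → b ≤ a → β ⊆ᶜ α → (b ∷ β) ⊆ᶜ (a ∷ α)

-- A cell (row , column), both 0-based, row 0 = bottom row, column 0 = leftmost.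
Cell : Set
Cell = ℕ × ℕ

row : Cell → ℕ
row = proj₁

col : Cell → ℕ
col = proj₂

rowLen : List ℕ → ℕ → ℕ
rowLen []      r       = 0
rowLen (a ∷ α) zero    = a
rowLen (a ∷ α) (suc r) = rowLen α r

Shape : Set₁
Shape = Cell → Set

Skew : List ℕ → List ℕ → Shape
Skew α β c = col c < rowLen α (row c) × ¬ (col c < rowLen β (row c))

cellsOf : List Cell → Shape
cellsOf A c = c ∈ A

RowSeparated : List Cell → List Cell → Set
RowSeparated A B =
  (∀ c → c ∈ A → ∀ d → d ∈ B → row c < row d) ⊎ (∀ c → c ∈ A → ∀ d → d ∈ B → row d < row c)

ColSeparated : List Cell → List Cell → Set
ColSeparated A B =
  (∀ c → c ∈ A → ∀ d → d ∈ B → col c < col d) ⊎ (∀ c → c ∈ A → ∀ d → d ∈ B → col d < col c)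

IsDisjointSum : List ℕ → List ℕ → List (List Cell) → Set
IsDisjointSum α β As =
    All (λ A → A ≢ []) As
  × (∀ c → (Skew α β c → Any (λ A → c ∈ A) As) × (Any (λ A → c ∈ A) As → Skew α β c))
  × AllPairs (λ A B → (∀ c → c ∈ A → c ∉ B) × RowSeparated A B × ColSeparated A B) As

StrictlyAbove : List Cell → List Cell → Set
StrictlyAbove A B = ∀ c → c ∈ A → ∀ d → d ∈ B → row d < row c

-- A filling with 1,…,m is represented by the list of positions of its entries:
-- lookup T i is the cell containing the entry (toℕ i + 1).
Tableau : Set
Tableau = List Cell

IsSET : Shape → Tableau → Set
IsSET S T =
    Unique T
  × (∀ c → (c ∈ T → S c) × (S c → c ∈ T))
  × (∀ (p q : Fin (length T)) → row (lookup T p) ≡ row (lookup T q)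
       → col (lookup T p) < col (lookup T q) → toℕ p < toℕ q)
  × (∀ (p q : Fin (length T)) → col (lookup T p) ≡ col (lookup T q)
       → row (lookup T p) < row (lookup T q) → toℕ p < toℕ q)

-- One nonzero application of some π_i. Here c holds entry i and d holds entry i+1
-- (i = length xs + 1).  If i+1 is strictly higher, π_i T = T; if strictly lower,
-- π_i T = s_i T (swap i and i+1); same row gives 0 (no step).
data _⟶π_ : Tableau → Tableau → Set where
  stay : ∀ xs c d ys → row c < row d → (xs ++ c ∷ d ∷ ys) ⟶π (xs ++ c ∷ d ∷ ys)
  swap : ∀ xs c d ys → row d < row c → (xs ++ c ∷ d ∷ ys) ⟶π (xs ++ d ∷ c ∷ ys)

_≤ₚ_ : Tableau → Tableau → Set
_≤ₚ_ = Star _⟶π_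

IsMinimal : Shape → Tableau → Set
IsMinimal S M = IsSET S M × (∀ T → IsSET S T → T ≤ₚ M → T ≡ M)

IsUniqueMinimal : Shape → Tableau → Set
IsUniqueMinimal S M = IsMinimal S M × (∀ M′ → IsMinimal S M′ → M′ ≡ M)

-- The tableau whose restriction to A_i is M_i with every entry a replaced by
-- a + n₁ + ⋯ + n_{i-1}: in the position-list representation, entries of M₁ come
-- first, then those of M₂ shifted by n₁ = |M₁|, etc., i.e. concatenation.
glue : List Tableau → Tableau
glue Ms = concat Ms

-- A tableau M is minimal in SET(S) exactly when, whenever i+1 lies strictly
-- higher than i, it lies in the same column: otherwise s_i M is again standard
-- and π_i (s_i M) = M; conversely, a nontrivial step π_i T = M would make i+1
-- rise into another column of M, since T is standard.  For the gluing of the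
-- M_i this local condition holds inside each block by minimality of M_i, and
-- at the junctions because A_{i+1} lies below A_i.  Conversely, in a minimal
-- tableau of α/β an entry of a lower block is never immediately followed by
-- one of a higher block (lying in another row and column, they could be
-- swapped back), so its entries come block by block; each block is then a
-- minimal tableau of its A_i, hence equal to M_i.
module Submission where

open import Level using (Level)
open import Defs
open import Data.Nat using (ℕ; _<_; s≤s; _≟_)
open import Data.Nat.Properties using (<-irrefl; <-asym; <-trans; <-cmp)
open import Data.Product using (_×_; _,_; proj₁; proj₂; ∃-syntax)
open import Data.Product.Properties using (≡-dec)
open import Data.Sum using (inj₁; inj₂)
open import Data.Empty using (⊥; ⊥-elim)
open import Data.Maybe.Relation.Unary.All as Maybe using (just)
open import Data.Maybe.Base using (just)
open import Data.Maybe.Relation.Binary.Connected using (Connected; just; just-nothing)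
open import Data.List using (List; []; _∷_; _++_; length; lookup; concat; head; takeWhile; dropWhile)
open import Data.List.Properties using (++-cancelˡ; ∷-injectiveˡ; tabulate-lookup; takeWhile++dropWhile)
open import Data.List.Membership.Propositional using (_∈_; _∉_; lose)
open import Data.List.Membership.Propositional.Properties using (∈-lookup; ∈-++⁻; ∈-concat⁺; ∈-concat⁻)
open import Data.List.Relation.Binary.Subset.Propositional using (_⊆_; _⊇_)
open import Data.List.Relation.Binary.Disjoint.Propositional using (Disjoint)
open import Data.List.Relation.Binary.Permutation.Propositional using (_↭_; ↭-sym; ↭-refl; ↭-swap)
open import Data.List.Relation.Binary.Permutation.Propositional.Properties using (All-resp-↭; ∈-resp-↭; ++⁺ˡ)
open import Data.List.Relation.Binary.Pointwise as Pointwise using (Pointwise; []; _∷_)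
open import Data.List.Relation.Unary.All as All using (All; []; _∷_)
open import Data.List.Relation.Unary.All.Properties as All using (anti-mono; all-takeWhile; all-head-dropWhile)
open import Data.List.Relation.Unary.Any using (Any; here; there)
open import Data.List.Relation.Unary.AllPairs as AllPairs using (AllPairs; []; _∷_)
open import Data.List.Relation.Unary.AllPairs.Properties using (tabulate⁺-<; concat⁺)
open import Data.List.Relation.Unary.Linked as Linked using (Linked; []; [-]; _∷_; _∷′_)
open import Data.Fin using (Fin; toℕ; zero; suc)
open import Data.Fin.Properties using (toℕ-injective)
open import Relation.Binary.Core using (Rel)
open import Relation.Binary.Definitions using (DecidableEquality; tri<; tri≈; tri>)
open import Relation.Binary.Construct.Closure.ReflexiveTransitive using (ε; _◅_)
open import Relation.Binary.PropositionalEquality using (_≡_; _≢_; refl; sym; trans; cong; cong₂; subst)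
open import Function using (_∘_)
open import Relation.Nullary using (¬_; yes; no)

private
  variable
    a ℓ : Level
    A : Set a
    R : Rel A ℓ
    x y : A
    xs ys zs : List A

allPairs-lookup : AllPairs R xs → (p q : Fin (length xs)) → toℕ p < toℕ q
                → R (lookup xs p) (lookup xs q)
allPairs-lookup (rx ∷ _)  zero    (suc q) _         = All.lookup rx (∈-lookup q)
allPairs-lookup (_ ∷ rxs) (suc p) (suc q) (s≤s p<q) = allPairs-lookup rxs p q p<q

allPairs-index< : {Q : Rel A ℓ} → AllPairs R xs → (∀ {x y} → R x y → ¬ Q y x) → (∀ {x} → ¬ Q x x)
                → (p q : Fin (length xs)) → Q (lookup xs p) (lookup xs q) → toℕ p < toℕ q
allPairs-index< rs R⇒¬Q⁻¹ Q-irrefl p q Qpq with <-cmp (toℕ p) (toℕ q)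
... | tri< p<q _ _ = p<q
... | tri≈ _ p≡q _ rewrite toℕ-injective p≡q = ⊥-elim (Q-irrefl Qpq)
... | tri> _ _ q<p = ⊥-elim (R⇒¬Q⁻¹ (allPairs-lookup rs q p q<p) Qpq)

allPairs-adjacent : ∀ xs → AllPairs R (xs ++ x ∷ y ∷ ys) → R x y
allPairs-adjacent []       ((rxy ∷ _) ∷ _) = rxy
allPairs-adjacent (_ ∷ xs) (_ ∷ rs)        = allPairs-adjacent xs rs

swap-↭ : ∀ xs → xs ++ x ∷ y ∷ ys ↭ xs ++ y ∷ x ∷ ys
swap-↭ xs = ++⁺ˡ xs (↭-swap _ _ ↭-refl)

allPairs-swap : ∀ xs → AllPairs R (xs ++ x ∷ y ∷ ys) → R y x → AllPairs R (xs ++ y ∷ x ∷ ys)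
allPairs-swap []       ((_ ∷ rx) ∷ ry ∷ rs) ryx = (ryx ∷ ry) ∷ rx ∷ rs
allPairs-swap (_ ∷ xs) (rz ∷ rs)            ryx = All-resp-↭ (swap-↭ xs) rz ∷ allPairs-swap xs rs ryx

allPairs-++⁻ : ∀ xs → AllPairs R (xs ++ ys) → AllPairs R xs × AllPairs R ys
allPairs-++⁻ []       rs        = [] , rs
allPairs-++⁻ (_ ∷ xs) (rx ∷ rs) = let rxs , rys = allPairs-++⁻ xs rs in All.++⁻ˡ xs rx ∷ rxs , rys

allPairs-concat⁻ : ∀ xss → AllPairs R (concat xss) → All (AllPairs R) xss
allPairs-concat⁻ []         _  = []
allPairs-concat⁻ (xs ∷ xss) rs = let rxs , rxss = allPairs-++⁻ xs rs in rxs ∷ allPairs-concat⁻ xss rxss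

linked-adjacent : ∀ xs → Linked R (xs ++ x ∷ y ∷ ys) → R x y
linked-adjacent []       rs = Linked.head rs
linked-adjacent (_ ∷ xs) rs = linked-adjacent xs (Linked.tail rs)

linked-from-adjacent : (∀ xs {x y} ys → xs ++ x ∷ y ∷ ys ≡ zs → R x y) → Linked R zs
linked-from-adjacent {zs = []}         _   = []
linked-from-adjacent {zs = _ ∷ []}     _   = [-]
linked-from-adjacent {zs = z ∷ _ ∷ _}  adj =
  adj [] _ refl ∷ linked-from-adjacent (λ xs ys eq → adj (z ∷ xs) ys (cong (z ∷_) eq))

linked-++⁺ : Linked R xs → Linked R ys → All (λ x → All (R x) ys) xs → Linked R (xs ++ ys)
linked-++⁺ []        rys _                = rys
linked-++⁺ [-]       rys (rx ∷ [])        = connect rx ∷′ rys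
  where
  connect : ∀ {x ys} → All (R x) ys → Connected R (just x) (head ys)
  connect []       = just-nothing
  connect (r ∷ _)  = just r
linked-++⁺ (r ∷ rxs) rys (_ ∷ rxys)       = r ∷ linked-++⁺ rxs rys rxys

linked-concat⁺ : ∀ {xss} → All (Linked R) xss → AllPairs (λ xs ys → All (λ x → All (R x) ys) xs) xss
               → Linked R (concat xss)
linked-concat⁺ []           []           = []
linked-concat⁺ (rxs ∷ rxss) (rx ∷ rxsxss) =
  linked-++⁺ rxs (linked-concat⁺ rxss rxsxss) (All.map All.concat⁺ (All.All-swap rx))

linked-++⁻ : ∀ xs → Linked R (xs ++ ys) → Linked R xs × Linked R ys
linked-++⁻ []            rs        = [] , rs
linked-++⁻ (_ ∷ [])      rs        = [-] , Linked.tail rs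
linked-++⁻ (_ ∷ _ ∷ xs)  (r ∷ rs)  = let rxs , rys = linked-++⁻ (_ ∷ xs) rs in r ∷ rxs , rys

linked-concat⁻ : ∀ xss → Linked R (concat xss) → All (Linked R) xss
linked-concat⁻ []         _  = []
linked-concat⁻ (xs ∷ xss) rs = let rxs , rxss = linked-++⁻ xs rs in rxs ∷ linked-concat⁻ xss rxss

pointwise⇒All : ∀ {b p q} {B : Set b} {P : A → B → Set p} {Q : B → Set q} {bs : List B}
              → (∀ {x y} → P x y → Q y) → Pointwise P xs bs → All Q bs
pointwise⇒All f []       = []
pointwise⇒All f (r ∷ rs) = f r ∷ pointwise⇒All f rs

any-⊆ : ∀ {xss yss : List (List A)} → Pointwise _⊆_ xss yss → Any (x ∈_) xss → Any (x ∈_) yss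
any-⊆ (xs⊆ys ∷ _)   (here x∈xs) = here (xs⊆ys x∈xs)
any-⊆ (_ ∷ xss⊆yss) (there x∈)  = there (any-⊆ xss⊆yss x∈)

data Later {X : Set a} : List (List X) → X → X → Set a where
  here  : ∀ {B Bs x y} → y ∈ B → Any (x ∈_) Bs → Later (B ∷ Bs) x y
  there : ∀ {B Bs x y} → Later Bs x y → Later (B ∷ Bs) x y

module _ {X : Set a} where

  InBlocks : List (List X) → List X → Set a
  InBlocks Bs = All (λ z → Any (z ∈_) Bs)

  NoStepBack : List (List X) → List X → Set a
  NoStepBack Bs = Linked (λ x y → ¬ Later Bs x y)

  once-out-always-out : ∀ {B Bs} (zs : List X) → Maybe.All (_∉ B) (head zs)
                      → InBlocks (B ∷ Bs) zs → NoStepBack (B ∷ Bs) zs → All (_∉ B) zs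
  once-out-always-out []           _          _                     _            = []
  once-out-always-out (_ ∷ [])     (just z∉B) _                     _            = z∉B ∷ []
  once-out-always-out (_ ∷ _ ∷ zs) (just z∉B) (here z∈B ∷ _)        _            = ⊥-elim (z∉B z∈B)
  once-out-always-out (_ ∷ _ ∷ zs) (just z∉B) (there z∈Bs ∷ inBs)   (¬back ∷ nb) =
    z∉B ∷ once-out-always-out (_ ∷ zs) (just (λ y∈B → ¬back (here y∈B z∈Bs))) inBs nb

  module _ (_≟_ : DecidableEquality X) where
    open import Data.List.Membership.DecPropositional _≟_ using (_∈?_)

    splitFirstBlock : ∀ B Bs (zs : List X) → InBlocks (B ∷ Bs) zs → NoStepBack (B ∷ Bs) zs
                    → ∃[ ws ] ∃[ rest ] B ⊇ ws × zs ≡ ws ++ rest × InBlocks Bs rest × NoStepBack Bs rest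
    splitFirstBlock B Bs zs inBs nb =
      ws , rest , All.lookup (all-takeWhile (_∈? B) zs) , zs≡ , All.zipWith dropFirst (inBs′ , rest∉B)
         , Linked.map (λ ¬back back → ¬back (there back)) nb′
      where
      ws rest : List X
      ws = takeWhile (_∈? B) zs
      rest = dropWhile (_∈? B) zs
      zs≡ : zs ≡ ws ++ rest
      zs≡ = sym (takeWhile++dropWhile (_∈? B) zs)
      inBs′ : InBlocks (B ∷ Bs) rest
      inBs′ = All.++⁻ʳ ws (subst (InBlocks (B ∷ Bs)) zs≡ inBs)
      nb′ : NoStepBack (B ∷ Bs) rest
      nb′ = proj₂ (linked-++⁻ ws (subst (NoStepBack (B ∷ Bs)) zs≡ nb))
      rest∉B : All (_∉ B) rest
      rest∉B = once-out-always-out rest (all-head-dropWhile (_∈? B) zs) inBs′ nb′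
      dropFirst : ∀ {z} → Any (z ∈_) (B ∷ Bs) × z ∉ B → Any (z ∈_) Bs
      dropFirst (here z∈B  , z∉B) = ⊥-elim (z∉B z∈B)
      dropFirst (there z∈Bs , _)  = z∈Bs

    sortedIntoBlocks : ∀ Bs (zs : List X) → InBlocks Bs zs → NoStepBack Bs zs
                     → ∃[ Ns ] Pointwise _⊇_ Bs Ns × zs ≡ concat Ns
    sortedIntoBlocks []       []      _        _  = [] , [] , refl
    sortedIntoBlocks []       (_ ∷ _) (() ∷ _) _
    sortedIntoBlocks (B ∷ Bs) zs      inBs     nb =
      let ws , rest , B⊇ws , zs≡ , inBs′ , nb′ = splitFirstBlock B Bs zs inBs nb
          Ns , Bs⊇Ns , rest≡                  = sortedIntoBlocks Bs rest inBs′ nb′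
      in  ws ∷ Ns , B⊇ws ∷ Bs⊇Ns , trans zs≡ (cong (ws ++_) rest≡)

  blocks-cover : ∀ {Bs Ns : List (List X)} → Pointwise _⊇_ Bs Ns → AllPairs Disjoint Bs
               → All (_⊆ concat Ns) Bs → Pointwise _⊆_ Bs Ns
  blocks-cover []                  []            []          = []
  blocks-cover {B ∷ Bs} {N ∷ Ns} (B⊇N ∷ Bs⊇Ns) (B#Bs ∷ #Bs) (B⊆ ∷ Bs⊆) =
    B⊆N ∷ blocks-cover Bs⊇Ns #Bs (All.zipWith dropN (B#Bs , Bs⊆))
    where
    B⊆N : B ⊆ N
    B⊆N x∈B with ∈-++⁻ N (B⊆ x∈B)
    ... | inj₁ x∈N  = x∈N
    ... | inj₂ x∈Ns = ⊥-elim (All.lookupWith (λ B#C x∈C → B#C (x∈B , x∈C)) B#Bs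
                                (any-⊆ (Pointwise.symmetric (λ C⊇M → C⊇M) Bs⊇Ns) (∈-concat⁻ Ns x∈Ns)))
    dropN : ∀ {C} → Disjoint B C × C ⊆ N ++ concat Ns → C ⊆ concat Ns
    dropN (B#C , C⊆) x∈C with ∈-++⁻ N (C⊆ x∈C)
    ... | inj₁ x∈N  = ⊥-elim (B#C (B⊇N x∈N , x∈C))
    ... | inj₂ x∈Ns = x∈Ns

LeftOf Below : Cell → Cell → Set
LeftOf c d = row c ≡ row d × col c < col d
Below  c d = col c ≡ col d × row c < row d

CanPrecede : Cell → Cell → Set
CanPrecede c d = c ≢ d × ¬ LeftOf d c × ¬ Below d c

Standard : Tableau → Set
Standard = AllPairs CanPrecede

Fills : Shape → Tableau → Set
Fills S T = ∀ c → (c ∈ T → S c) × (S c → c ∈ T)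

isSET⇒standard : ∀ {S T} → IsSET S T → Standard T
isSET⇒standard {T = T} (unique , _ , rows , cols) = subst Standard (tabulate-lookup T) (tabulate⁺-< precede)
  where
  precede : ∀ {p q} → toℕ p < toℕ q → CanPrecede (lookup T p) (lookup T q)
  precede {p} {q} p<q = allPairs-lookup unique p q p<q
                      , (λ (same , left) → <-asym p<q (rows q p same left))
                      , (λ (same , below) → <-asym p<q (cols q p same below))

standard⇒isSET : ∀ {S T} → Standard T → Fills S T → IsSET S T
standard⇒isSET st fills =
    AllPairs.map proj₁ st
  , fills
  , (λ p q same left → allPairs-index< st (proj₁ ∘ proj₂) (λ (_ , l) → <-irrefl refl l) p q (same , left))
  , (λ p q same below → allPairs-index< st (proj₂ ∘ proj₂) (λ (_ , l) → <-irrefl refl l) p q (same , below))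

precedes-below : ∀ {c d} → row c < row d → CanPrecede c d
precedes-below c<d = (λ c≡d → <-irrefl (cong row c≡d) c<d)
                   , (λ (same , _) → <-irrefl (sym same) c<d)
                   , (λ (_ , d<c) → <-asym d<c c<d)

precedes-apart : ∀ {c d} → row c ≢ row d → col c ≢ col d → CanPrecede c d
precedes-apart rows≢ cols≢ = (λ c≡d → rows≢ (cong row c≡d))
                           , (λ (same , _) → rows≢ (sym same))
                           , (λ (same , _) → cols≢ (sym same))

swap-isSET : ∀ {S} xs {c d ys} → IsSET S (xs ++ c ∷ d ∷ ys) → CanPrecede d c → IsSET S (xs ++ d ∷ c ∷ ys)
swap-isSET {S} xs {c} {d} {ys} setT d≺c = standard⇒isSET (allPairs-swap xs (isSET⇒standard setT) d≺c) fills
  where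
  fills : Fills S (xs ++ d ∷ c ∷ ys)
  fills e = (λ e∈ → proj₁ (proj₁ (proj₂ setT) e) (∈-resp-↭ (↭-sym (swap-↭ xs)) e∈))
          , (λ inS → ∈-resp-↭ (swap-↭ xs) (proj₂ (proj₁ (proj₂ setT) e) inS))

VerticalRise : Cell → Cell → Set
VerticalRise c d = row c < row d → col c ≡ col d

minimal⇒no-oblique-rise : ∀ {S} xs {c d ys} → IsMinimal S (xs ++ c ∷ d ∷ ys)
                      → row c < row d → col c ≢ col d → ⊥
minimal⇒no-oblique-rise xs {c} {d} {ys} (setM , minM) c<d cols≢ = <-irrefl (cong row (sym d≡c)) c<d
  where
  swapped≡ : xs ++ d ∷ c ∷ ys ≡ xs ++ c ∷ d ∷ ys
  swapped≡ = minM _ (swap-isSET xs setM (precedes-apart (λ same → <-irrefl (sym same) c<d) (cols≢ ∘ sym)))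
                    (swap xs d c ys c<d ◅ ε)
  d≡c : d ≡ c
  d≡c = ∷-injectiveˡ (++-cancelˡ xs _ _ swapped≡)

minimal⇒verticalRises : ∀ {S M} → IsMinimal S M → Linked VerticalRise M
minimal⇒verticalRises {S} {M} minM = linked-from-adjacent rise
  where
  rise : ∀ xs {c d} ys → xs ++ c ∷ d ∷ ys ≡ M → VerticalRise c d
  rise xs {c} {d} ys M≡ c<d with col c ≟ col d
  ... | yes same  = same
  ... | no cols≢ = ⊥-elim (minimal⇒no-oblique-rise xs (subst (IsMinimal S) (sym M≡) minM) c<d cols≢)

≤ₚ-verticalRises⇒≡ : ∀ {T M} → Standard T → Linked VerticalRise M → T ≤ₚ M → T ≡ M
≤ₚ-verticalRises⇒≡ st vr ε                                = refl
≤ₚ-verticalRises⇒≡ st vr (stay _ _ _ _ _ ◅ steps)         = ≤ₚ-verticalRises⇒≡ st vr steps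
≤ₚ-verticalRises⇒≡ {M = M} st vr (swap xs c d ys d<c ◅ steps) =
  ⊥-elim (proj₂ (proj₂ (allPairs-adjacent xs st)) (vertical d<c , d<c))
  where
  swapped≡ : xs ++ d ∷ c ∷ ys ≡ M
  swapped≡ = ≤ₚ-verticalRises⇒≡ (allPairs-swap xs st (precedes-below d<c)) vr steps
  vertical : VerticalRise d c
  vertical = linked-adjacent xs (subst (Linked VerticalRise) (sym swapped≡) vr)

verticalRises⇒minimal : ∀ {S M} → IsSET S M → Linked VerticalRise M → IsMinimal S M
verticalRises⇒minimal setM vr = setM , λ T setT T≤M → ≤ₚ-verticalRises⇒≡ (isSET⇒standard setT) vr T≤M

AboveApart : Cell → Cell → Set
AboveApart c d = row d < row c × col c ≢ col d

BlockAbove : List Cell → List Cell → Set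
BlockAbove A B = All (λ c → All (AboveApart c) B) A

aboveApart⇒canPrecede : ∀ {c d} → AboveApart c d → CanPrecede c d
aboveApart⇒canPrecede (d<c , cols≢) = precedes-apart (λ same → <-irrefl (sym same) d<c) cols≢

aboveApart⇒verticalRise : ∀ {c d} → AboveApart c d → VerticalRise c d
aboveApart⇒verticalRise (d<c , _) c<d = ⊥-elim (<-asym d<c c<d)

blockAbove⇒disjoint : ∀ {A B} → BlockAbove A B → Disjoint A B
blockAbove⇒disjoint A>B (x∈A , x∈B) = <-irrefl refl (proj₁ (All.lookup (All.lookup A>B x∈A) x∈B))

blockAbove-anti-mono : ∀ {As Ns} → Pointwise _⊇_ As Ns → AllPairs BlockAbove As → AllPairs BlockAbove Ns
blockAbove-anti-mono []              []                = []
blockAbove-anti-mono {A ∷ _} {N ∷ _} (A⊇N ∷ As⊇Ns) (A>As ∷ layered) =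
  lower As⊇Ns A>As ∷ blockAbove-anti-mono As⊇Ns layered
  where
  lower : ∀ {Bs Ms} → Pointwise _⊇_ Bs Ms → All (BlockAbove A) Bs → All (BlockAbove N) Ms
  lower []              []            = []
  lower (B⊇M ∷ Bs⊇Ms) (A>B ∷ A>Bs) = All.map (anti-mono B⊇M) (anti-mono A⊇N A>B) ∷ lower Bs⊇Ms A>Bs

later⇒aboveApart : ∀ {Bs x y} → AllPairs BlockAbove Bs → Later Bs x y → AboveApart y x
later⇒aboveApart (B>Bs ∷ _) (here y∈B x∈Bs) =
  All.lookupWith (λ B>C x∈C → All.lookup (All.lookup B>C y∈B) x∈C) B>Bs x∈Bs
later⇒aboveApart (_ ∷ layered) (there later) = later⇒aboveApart layered later

strictlyAbove-trans : ∀ {A B C} → B ≢ [] → StrictlyAbove A B → StrictlyAbove B C → StrictlyAbove A C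
strictlyAbove-trans {B = []}    B≢[] _   _   = ⊥-elim (B≢[] refl)
strictlyAbove-trans {B = b ∷ _} _    A>B B>C c c∈A e e∈C = <-trans (B>C b (here refl) e e∈C) (A>B c c∈A b (here refl))

linked⇒allPairs-above : ∀ {As} → All (_≢ []) As → Linked StrictlyAbove As → AllPairs StrictlyAbove As
linked⇒allPairs-above []                      []         = []
linked⇒allPairs-above (_ ∷ [])                [-]        = [] ∷ []
linked⇒allPairs-above (_ ∷ B≢[] ∷ nonempty) (A>B ∷ lk) with linked⇒allPairs-above (B≢[] ∷ nonempty) lk
... | B>Cs ∷ rest = (A>B ∷ All.map (strictlyAbove-trans B≢[] A>B) B>Cs) ∷ B>Cs ∷ rest

colSeparated⇒≢ : ∀ {A B} → ColSeparated A B → ∀ c → c ∈ A → ∀ d → d ∈ B → col c ≢ col d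
colSeparated⇒≢ (inj₁ A<B) c c∈A d d∈B same = <-irrefl same (A<B c c∈A d d∈B)
colSeparated⇒≢ (inj₂ B<A) c c∈A d d∈B same = <-irrefl (sym same) (B<A c c∈A d d∈B)

blocksAbove : ∀ {α β As} → IsDisjointSum α β As → Linked StrictlyAbove As → AllPairs BlockAbove As
blocksAbove (nonempty , _ , separated) above =
  AllPairs.zipWith stack (linked⇒allPairs-above nonempty above , separated)
  where
  stack : ∀ {A B} → StrictlyAbove A B × (∀ c → c ∈ A → c ∉ B) × RowSeparated A B × ColSeparated A B
        → BlockAbove A B
  stack (A>B , _ , _ , cols) =
    All.tabulate λ c∈A → All.tabulate λ d∈B → A>B _ c∈A _ d∈B , colSeparated⇒≢ cols _ c∈A _ d∈B

IsUnionOf : Shape → List (List Cell) → Set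
IsUnionOf S As = ∀ c → (S c → Any (c ∈_) As) × (Any (c ∈_) As → S c)

concat-minimal : ∀ {S As Ms} → IsUnionOf S As → AllPairs BlockAbove As
               → Pointwise (λ A M → IsMinimal (cellsOf A) M) As Ms → IsMinimal S (concat Ms)
concat-minimal {S} {As} {Ms} union layered minMs = verticalRises⇒minimal (standard⇒isSET standard fills) rises
  where
  As⊇Ms : Pointwise _⊇_ As Ms
  As⊇Ms = Pointwise.map (λ ((_ , fillsM , _) , _) {c} → proj₁ (fillsM c)) minMs
  As⊆Ms : Pointwise _⊆_ As Ms
  As⊆Ms = Pointwise.map (λ ((_ , fillsM , _) , _) {c} → proj₂ (fillsM c)) minMs
  Ms-layered : AllPairs BlockAbove Ms
  Ms-layered = blockAbove-anti-mono As⊇Ms layered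
  standard : Standard (concat Ms)
  standard = concat⁺ (pointwise⇒All (isSET⇒standard ∘ proj₁) minMs)
                     (AllPairs.map (All.map (All.map aboveApart⇒canPrecede)) Ms-layered)
  rises : Linked VerticalRise (concat Ms)
  rises = linked-concat⁺ (pointwise⇒All minimal⇒verticalRises minMs)
                         (AllPairs.map (All.map (All.map aboveApart⇒verticalRise)) Ms-layered)
  fills : Fills S (concat Ms)
  fills c = (λ c∈ → proj₂ (union c) (any-⊆ (Pointwise.symmetric (λ M⊆A → M⊆A) As⊇Ms) (∈-concat⁻ Ms c∈)))
          , (λ inS → ∈-concat⁺ (any-⊆ As⊆Ms (proj₁ (union c) inS)))

blocks-unique : ∀ {As Ns Ms} → All Standard Ns → All (Linked VerticalRise) Ns
              → Pointwise _⊇_ As Ns → Pointwise _⊆_ As Ns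
              → Pointwise (λ A M → IsUniqueMinimal (cellsOf A) M) As Ms → Ns ≡ Ms
blocks-unique []           []           []              []              []                 = refl
blocks-unique (stN ∷ stNs) (vrN ∷ vrNs) (A⊇N ∷ As⊇Ns) (A⊆N ∷ As⊆Ns) ((_ , unique) ∷ uniqueMs) =
  cong₂ _∷_ (unique _ (verticalRises⇒minimal (standard⇒isSET stN (λ c → A⊇N , A⊆N)) vrN))
            (blocks-unique stNs vrNs As⊇Ns As⊆Ns uniqueMs)

minimal≡concat : ∀ {S As Ms M} → IsUnionOf S As → AllPairs BlockAbove As
               → Pointwise (λ A M → IsUniqueMinimal (cellsOf A) M) As Ms → IsMinimal S M → M ≡ concat Ms
minimal≡concat {S} {As} {Ms} {M} union layered uniqueMs minM@(setM@(_ , fillsM , _) , _)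
  with sortedIntoBlocks (≡-dec _≟_ _≟_) As M inBlocks noStepBack
  where
  inBlocks : InBlocks As M
  inBlocks = All.tabulate λ {c} c∈M → proj₁ (union c) (proj₁ (fillsM c) c∈M)
  noStepBack : NoStepBack As M
  noStepBack = Linked.map (λ rise later → let x<y , cols≢ = later⇒aboveApart layered later
                                          in  cols≢ (sym (rise x<y)))
                          (minimal⇒verticalRises minM)
... | Ns , As⊇Ns , refl =
  cong concat (blocks-unique (allPairs-concat⁻ Ns (isSET⇒standard setM))
                             (linked-concat⁻ Ns (minimal⇒verticalRises minM))
                             As⊇Ns As⊆Ns uniqueMs)
  where
  As⊆Ns : Pointwise _⊆_ As Ns
  As⊆Ns = blocks-cover As⊇Ns (AllPairs.map blockAbove⇒disjoint layered)
            (All.tabulate λ A∈As {c} c∈A → proj₂ (fillsM c) (proj₂ (union c) (lose A∈As c∈A)))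

proposition17 : (α β : List ℕ) → IsComposition α → IsComposition β → β ⊆ᶜ α
    → (As : List (List Cell)) → IsDisjointSum α β As → Linked StrictlyAbove As
    → (Ms : List Tableau) → Pointwise (λ A M → IsUniqueMinimal (cellsOf A) M) As Ms
    → IsUniqueMinimal (Skew α β) (glue Ms)
proposition17 α β _ _ _ As sum above Ms uniqueMs =
    concat-minimal union layered (Pointwise.map proj₁ uniqueMs)
  , λ M minM → minimal≡concat union layered uniqueMs minM
  where
  union : IsUnionOf (Skew α β) As
  union = proj₁ (proj₂ sum)
  layered : AllPairs BlockAbove As
  layered = blocksAbove {α} {β} sum above
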